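{- Let $r\geq 2$ be an integer and let $G$ be a standard multigraph on $n$ vertices. If $\delta(G)>2(1-\frac{1}{r-1})n$ or $e(G)>(1-\frac{1}{r-1})n^2$, then $G$ contains a copy of some element of $\bar{\mathcal K}_{r}$.
   Context: A standard multigraph is a loopless multigraph in which any two distinct vertices $x,y$ are joined by $\mu(xy)\in\{0,1,2\}$ edges (light if $1$, heavy if $2$); degrees and $e(G)$ count edges with multiplicity, and $\delta(G)$ is the minimum degree. $\bar{\mathcal K}_r$ is the family of standard multigraphs on $r$ vertices in which every pair of distinct vertices is joined by a heavy edge except for the pairs of some matching, which are joined by light edges. $G$ contains a copy of $U$ if there is an injection $\phi:V(U)\to V(G)$ with $\mu_G(\phi(x)\phi(y))\geq\mu_U(xy)$ for all distinct $x,y\in V(U)$. -}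

module Defs where

open import Data.Nat using (ℕ; zero; suc; _+_; _*_; _∸_; _≤_; _<_; _⊓_)
open import Data.Fin using (Fin; zero; suc)
open import Data.List using (List; []; _∷_; map; foldr)
open import Data.Nat.ListAction using (sum)
open import Data.List using (allFin)
open import Data.Product using (Σ; _×_; _,_)
open import Relation.Binary.PropositionalEquality using (_≡_; _≢_)
open import Relation.Nullary using (¬_)
open import Function.Definitions using (Injective)

record StdMultigraph (n : ℕ) : Set where
  field
    μ     : Fin n → Fin n → ℕ
    sym   : ∀ x y → μ x y ≡ μ y x
    loopless : ∀ x → μ x x ≡ 0
    le2   : ∀ x y → μ x y ≤ 2
open StdMultigraph public

deg : ∀ {n} → StdMultigraph n → Fin n → ℕ
deg {n} G x = sum (map (μ G x) (allFin n))

-- sum of degrees = 2 e(G)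
degSum : ∀ {n} → StdMultigraph n → ℕ
degSum {n} G = sum (map (deg G) (allFin n))

minList : ℕ → List ℕ → ℕ
minList a xs = foldr _⊓_ a xs

-- minimum degree δ(G); convention δ = 0 for the empty graph
δ : ∀ {n} → StdMultigraph n → ℕ
δ {zero} G = 0
δ {suc n} G = minList (deg G zero) (map (λ i → deg G (suc i)) (allFin n))

-- A matching on Fin r encoded as an involution m (m x ≡ x); the matched pairs
-- are the {x , m x} with m x ≢ x.
IsInvolution : ∀ {r} → (Fin r → Fin r) → Set
IsInvolution m = ∀ x → m (m x) ≡ x

InKbar : ∀ {r} → StdMultigraph r → Set
InKbar {r} U = Σ (Fin r → Fin r) λ m → IsInvolution m ×
  (∀ x y → x ≢ y → (y ≡ m x → μ U x y ≡ 1) × (¬ (y ≡ m x) → μ U x y ≡ 2))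

ContainsCopy : ∀ {n r} → StdMultigraph n → StdMultigraph r → Set
ContainsCopy {n} {r} G U = Σ (Fin r → Fin n) λ φ → Injective _≡_ _≡_ φ ×
  (∀ x y → x ≢ y → μ U x y ≤ μ G (φ x) (φ y))

-- Turán's argument for standard multigraphs. By induction on a: every vertex list L either
-- spans a copy of a member of K̄_(a+2), or its degree sum is at most 2a/(a+1)·|L|².
-- For the step, let L span a copy X of a member of K̄_(a+1). A vertex y outside X with
-- at least 2a+1 edges into X is joined to X by heavy edges except for at most one light
-- edge, to x say. If there is no light edge, or x is unmatched in X, then X + y is a copy
-- of a member of K̄_(a+2); otherwise replace x by y, which unmatches x and its partner and
-- so can happen only finitely often. If there is no such y, the degree sum of L splits
-- into that of X, at most (a+1)·2a, twice the edges between X and the rest, at most 2a per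
-- outside vertex, and that of the rest, bounded by induction on |L|.
module Submission where

open import Defs renaming (sym to μ-sym)
open import Data.Empty using (⊥; ⊥-elim)
open import Data.Fin using (Fin; zero; suc)
open import Data.Fin.Properties using (_≟_)
open import Data.List using (List; []; _∷_; _++_; map; length; allFin)
open import Data.List.Properties using (map-++; map-∘; map-cong; map-tabulate; length-++; length-map; length-tabulate)
open import Data.List.Membership.Propositional using (_∈_)
open import Data.List.Membership.Propositional.Properties using (∈-map⁺; ∈-allFin)
open import Data.List.Relation.Binary.Permutation.Propositional
  using (_↭_; ↭-refl; ↭-trans; ↭-prep; ↭-swap; module PermutationReasoning)
open import Data.List.Relation.Binary.Permutation.Propositional.Properties
  using (++⁺ˡ; ++⁺ʳ; shift; shifts; ↭-length; map⁺)
open import Data.List.Relation.Unary.All using (All; []; _∷_; universal)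
open import Data.List.Relation.Unary.Any using (here; there)
open import Data.Nat using (ℕ; zero; suc; _+_; _*_; _∸_; _≤_; _<_; _≤?_; z≤n; s≤s)
open import Data.Nat.Induction using (Acc; acc; <-wellFounded)
open import Data.Nat.ListAction using (sum)
open import Data.Nat.ListAction.Properties using (sum-++; sum-↭)
open import Data.Nat.Properties hiding (_≟_)
open import Algebra.Properties.CommutativeSemigroup +-commutativeSemigroup using (interchange)
open import Data.Nat.Tactic.RingSolver using (solve-∀)
open import Data.Bool using (if_then_else_)
open import Data.Product using (Σ; ∃; _×_; _,_)
open import Data.Sum using (_⊎_; inj₁; inj₂; [_,_]′; map₂)
open import Data.Vec.Functional as Vector using (updateAt)
open import Data.Vec.Functional.Properties using (updateAt-updates; updateAt-minimal)
open import Function using (_∘_; id; const)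
open import Function.Definitions using (Injective)
open import Relation.Binary.PropositionalEquality
open import Relation.Nullary using (¬_; Dec; yes; no; does)
open import Relation.Nullary.Decidable using (dec-true; dec-false; _⊎-dec_)
open import Relation.Unary using (Decidable)

private variable
  A : Set
  a c k t : ℕ

∑ : List A → (A → ℕ) → ℕ
∑ xs f = sum (map f xs)

∑-++ : ∀ xs ys (f : A → ℕ) → ∑ (xs ++ ys) f ≡ ∑ xs f + ∑ ys f
∑-++ xs ys f = trans (cong sum (map-++ f xs ys)) (sum-++ (map f xs) (map f ys))

∑-+ : ∀ xs (f g : A → ℕ) → ∑ xs (λ x → f x + g x) ≡ ∑ xs f + ∑ xs g
∑-+ []       f g = refl
∑-+ (x ∷ xs) f g = trans (cong (f x + g x +_) (∑-+ xs f g)) (interchange (f x) (g x) (∑ xs f) (∑ xs g))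

∑-cong : ∀ xs {f g : A → ℕ} → (∀ x → f x ≡ g x) → ∑ xs f ≡ ∑ xs g
∑-cong xs f≗g = cong sum (map-cong f≗g xs)

∑-mono : ∀ {xs} {f g : A → ℕ} → All (λ x → f x ≤ g x) xs → ∑ xs f ≤ ∑ xs g
∑-mono []           = z≤n
∑-mono (fx≤gx ∷ ps) = +-mono-≤ fx≤gx (∑-mono ps)

∑-const : ∀ (xs : List A) c → ∑ xs (const c) ≡ length xs * c
∑-const []       c = refl
∑-const (x ∷ xs) c = cong (c +_) (∑-const xs c)

∑-↭ : ∀ {xs ys} (f : A → ℕ) → xs ↭ ys → ∑ xs f ≡ ∑ ys f
∑-↭ f xs↭ys = sum-↭ (map⁺ f xs↭ys)

∑-map : ∀ {B : Set} (g : A → B) xs (f : B → ℕ) → ∑ (map g xs) f ≡ ∑ xs (f ∘ g)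
∑-map g xs f = cong sum (sym (map-∘ xs))

∑-comm : ∀ {B : Set} xs (ys : List B) (f : A → B → ℕ) →
  ∑ xs (λ x → ∑ ys (f x)) ≡ ∑ ys (λ y → ∑ xs (λ x → f x y))
∑-comm []       ys f = sym (trans (∑-const ys 0) (*-zeroʳ (length ys)))
∑-comm (x ∷ xs) ys f =
  trans (cong (∑ ys (f x) +_) (∑-comm xs ys f)) (sym (∑-+ ys (f x) (λ y → ∑ xs (λ x → f x y))))

image : (Fin k → A) → List A
image {k = k} φ = map φ (allFin k)

length-image : (φ : Fin k → A) → length (image φ) ≡ k
length-image {k = k} φ = trans (length-map φ (allFin k)) (length-tabulate id)

image-suc : (φ : Fin (suc k) → A) → image φ ≡ φ zero ∷ image (φ ∘ suc)
image-suc φ = cong (φ zero ∷_) (trans (map-tabulate suc φ) (sym (map-tabulate id (φ ∘ suc))))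

image-updateAt : (φ : Fin k → A) (i : Fin k) (y : A) → φ i ∷ image (updateAt φ i (const y)) ↭ y ∷ image φ
image-updateAt φ zero y rewrite image-suc φ | image-suc (updateAt φ zero (const y)) = ↭-swap (φ zero) y ↭-refl
image-updateAt φ (suc i) y rewrite image-suc φ | image-suc (updateAt φ (suc i) (const y)) =
  ↭-trans (↭-swap (φ (suc i)) (φ zero) ↭-refl)
    (↭-trans (↭-prep (φ zero) (image-updateAt (φ ∘ suc) i y)) (↭-swap (φ zero) y ↭-refl))

++-attach : ∀ (φ : Fin k → A) {R y Z} → R ↭ y ∷ Z → image φ ++ R ↭ image (y Vector.∷ φ) ++ Z
++-attach φ {R} {y} {Z} R↭ = begin
  image φ ++ R           ↭⟨ ++⁺ˡ (image φ) R↭ ⟩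
  image φ ++ y ∷ Z       ↭⟨ shift y (image φ) Z ⟩
  y ∷ image φ ++ Z       ≡⟨ cong (_++ Z) (image-suc (y Vector.∷ φ)) ⟨
  image (y Vector.∷ φ) ++ Z ∎
  where open PermutationReasoning

++-exchange : ∀ (φ : Fin k → A) i {R y Z} → R ↭ y ∷ Z →
  image φ ++ R ↭ image (updateAt φ i (const y)) ++ φ i ∷ Z
++-exchange φ i {R} {y} {Z} R↭ = begin
  image φ ++ R                                ↭⟨ ++⁺ˡ (image φ) R↭ ⟩
  image φ ++ y ∷ Z                            ↭⟨ shift y (image φ) Z ⟩
  (y ∷ image φ) ++ Z                          ↭⟨ ++⁺ʳ Z (image-updateAt φ i y) ⟨
  φ i ∷ image (updateAt φ i (const y)) ++ Z   ↭⟨ shift (φ i) (image (updateAt φ i (const y))) Z ⟨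
  image (updateAt φ i (const y)) ++ φ i ∷ Z   ∎
  where open PermutationReasoning

All-or-extract : {P : A → Set} → Decidable P → ∀ xs →
  All P xs ⊎ Σ A λ y → Σ (List A) λ zs → (xs ↭ y ∷ zs) × ¬ P y
All-or-extract P? [] = inj₁ []
All-or-extract P? (x ∷ xs) with P? x
... | no ¬Px = inj₂ (x , xs , ↭-refl , ¬Px)
... | yes Px with All-or-extract P? xs
...   | inj₁ all = inj₁ (Px ∷ all)
...   | inj₂ (y , zs , xs↭ , ¬Py) = inj₂ (y , x ∷ zs , ↭-trans (↭-prep x xs↭) (↭-swap x y ↭-refl) , ¬Py)

∑Fin : (Fin t → ℕ) → ℕ
∑Fin {t} f = ∑ (allFin t) f

∑Fin-suc : (f : Fin (suc t) → ℕ) → ∑Fin f ≡ f zero + ∑Fin (f ∘ suc)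
∑Fin-suc f = cong sum (image-suc f)

∑Fin-mono : {f g : Fin t → ℕ} → (∀ i → f i ≤ g i) → ∑Fin f ≤ ∑Fin g
∑Fin-mono {t} {f} {g} f≤g = ∑-mono {xs = allFin t} {f} {g} (universal f≤g (allFin t))

∑Fin-≤ : {f : Fin t → ℕ} → (∀ i → f i ≤ c) → ∑Fin f ≤ t * c
∑Fin-≤ {t} {c} {f} f≤c = begin
  ∑Fin f                 ≤⟨ ∑Fin-mono f≤c ⟩
  ∑ (allFin t) (const c) ≡⟨ ∑-const (allFin t) c ⟩
  length (allFin t) * c  ≡⟨ cong (_* c) (length-tabulate {n = t} id) ⟩
  t * c                  ∎
  where open ≤-Reasoning

∑Fin-≤-with-zero : {f : Fin (suc t) → ℕ} (i₀ : Fin (suc t)) → f i₀ ≡ 0 → (∀ i → f i ≤ c) → ∑Fin f ≤ t * c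
∑Fin-≤-with-zero {f = f} zero f0≡0 f≤c rewrite ∑Fin-suc f | f0≡0 = ∑Fin-≤ (f≤c ∘ suc)
∑Fin-≤-with-zero {suc t} {f = f} (suc i₀) fi₀≡0 f≤c rewrite ∑Fin-suc f =
  +-mono-≤ (f≤c zero) (∑Fin-≤-with-zero i₀ fi₀≡0 (f≤c ∘ suc))

∑Fin-< : {f g : Fin t → ℕ} → (∀ i → f i ≤ g i) → (i₀ : Fin t) → f i₀ < g i₀ → ∑Fin f < ∑Fin g
∑Fin-< {f = f} {g} f≤g zero lt rewrite ∑Fin-suc f | ∑Fin-suc g =
  +-mono-<-≤ lt (∑Fin-mono (f≤g ∘ suc))
∑Fin-< {f = f} {g} f≤g (suc i₀) lt rewrite ∑Fin-suc f | ∑Fin-suc g =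
  +-mono-≤-< (f≤g zero) (∑Fin-< (f≤g ∘ suc) i₀ lt)

squeeze : ∀ {m n o p} → m ≤ o → n ≤ p → o + p ≤ m + n → o ≤ m × p ≤ n
squeeze {m} {n} {o} {p} m≤o n≤p h =
  +-cancelʳ-≤ p o m (≤-trans h (+-monoʳ-≤ m n≤p)) , +-cancelˡ-≤ o p n (≤-trans h (+-monoˡ-≤ n m≤o))

HeavyExcept : (Fin t → ℕ) → Fin t → Set
HeavyExcept f i₀ = 1 ≤ f i₀ × (∀ i → i ≢ i₀ → 2 ≤ f i)

HeavyExcept⇒positive : {f : Fin t → ℕ} {i₀ : Fin t} → HeavyExcept f i₀ → ∀ i → 1 ≤ f i
HeavyExcept⇒positive {i₀ = i₀} (1≤fi₀ , heavy) i with i ≟ i₀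
... | yes refl = 1≤fi₀
... | no i≢i₀ = <⇒≤ (heavy i i≢i₀)

full⇒heavy : (f : Fin t → ℕ) → (∀ i → f i ≤ 2) → t * 2 ≤ ∑Fin f → ∀ i → 2 ≤ f i
full⇒heavy {suc t} f f≤2 full
  with squeeze (f≤2 zero) (∑Fin-≤ (f≤2 ∘ suc)) (subst (suc t * 2 ≤_) (∑Fin-suc f) full)
... | 2≤f0 , restFull = λ { zero → 2≤f0 ; (suc i) → full⇒heavy (f ∘ suc) (f≤2 ∘ suc) restFull i }

almostFull⇒heavyExcept : (f : Fin t → ℕ) → (∀ i → f i ≤ 2) → t * 2 ≤ suc (∑Fin f) →
  (∀ i → 2 ≤ f i) ⊎ ∃ (HeavyExcept f)
almostFull⇒heavyExcept {zero} f f≤2 h = inj₁ λ ()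
almostFull⇒heavyExcept {suc t} f f≤2 h rewrite ∑Fin-suc f with 2 ≤? f zero
... | no f0≱2 with squeeze (≰⇒> f0≱2) (∑Fin-≤ (f≤2 ∘ suc)) h
...   | 2≤1+f0 , restFull = inj₂ (zero , ≤-pred 2≤1+f0 , λ
          { zero 0≢0 → ⊥-elim (0≢0 refl)
          ; (suc i) _ → full⇒heavy (f ∘ suc) (f≤2 ∘ suc) restFull i })
almostFull⇒heavyExcept {suc t} f f≤2 h | yes 2≤f0
  with f zero | ≤-antisym (f≤2 zero) 2≤f0
... | _ | refl with almostFull⇒heavyExcept (f ∘ suc) (f≤2 ∘ suc) (≤-pred (≤-pred h))
...   | inj₁ heavy = inj₁ λ { zero → 2≤f0 ; (suc i) → heavy i }
...   | inj₂ (i₀ , 1≤fi₀ , heavy) =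
  inj₂ (suc i₀ , 1≤fi₀ , λ { zero _ → 2≤f0 ; (suc i) si≢si₀ → heavy i (si≢si₀ ∘ cong suc) })

involution-swap : {m : Fin k → Fin k} → IsInvolution m → ∀ {i j} → j ≡ m i → i ≡ m j
involution-swap {m = m} inv {i} j≡mi = trans (sym (inv i)) (cong m (sym j≡mi))

kbarμ : (Fin k → Fin k) → Fin k → Fin k → ℕ
kbarμ m i j with i ≟ j
... | yes _ = 0
... | no _ with j ≟ m i
...   | yes _ = 1
...   | no _ = 2

kbarμ-diag : (m : Fin k → Fin k) → ∀ i → kbarμ m i i ≡ 0
kbarμ-diag m i with i ≟ i
... | yes _ = refl
... | no i≢i = ⊥-elim (i≢i refl)

kbarμ-light : {m : Fin k → Fin k} {i j : Fin k} → i ≢ j → j ≡ m i → kbarμ m i j ≡ 1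
kbarμ-light {m = m} {i} {j} i≢j j≡mi with i ≟ j
... | yes i≡j = ⊥-elim (i≢j i≡j)
... | no _ with j ≟ m i
...   | yes _ = refl
...   | no j≢mi = ⊥-elim (j≢mi j≡mi)

kbarμ-heavy : {m : Fin k → Fin k} {i j : Fin k} → i ≢ j → j ≢ m i → kbarμ m i j ≡ 2
kbarμ-heavy {m = m} {i} {j} i≢j j≢mi with i ≟ j
... | yes i≡j = ⊥-elim (i≢j i≡j)
... | no _ with j ≟ m i
...   | yes j≡mi = ⊥-elim (j≢mi j≡mi)
...   | no _ = refl

kbarμ-sym : {m : Fin k → Fin k} → IsInvolution m → ∀ i j → kbarμ m i j ≡ kbarμ m j i
kbarμ-sym {m = m} inv i j with i ≟ j
... | yes refl = sym (kbarμ-diag m i)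
... | no i≢j with j ≟ m i
...   | yes j≡mi = sym (kbarμ-light (i≢j ∘ sym) (involution-swap inv j≡mi))
...   | no j≢mi = sym (kbarμ-heavy (i≢j ∘ sym) (j≢mi ∘ involution-swap inv))

kbarμ-≤2 : (m : Fin k → Fin k) → ∀ i j → kbarμ m i j ≤ 2
kbarμ-≤2 m i j with i ≟ j
... | yes _ = z≤n
... | no _ with j ≟ m i
...   | yes _ = s≤s z≤n
...   | no _ = ≤-refl

kbar : (m : Fin k → Fin k) → IsInvolution m → StdMultigraph k
kbar m inv = record { μ = kbarμ m ; sym = kbarμ-sym inv ; loopless = kbarμ-diag m ; le2 = kbarμ-≤2 m }

kbar-InKbar : {m : Fin k → Fin k} (inv : IsInvolution m) → InKbar (kbar m inv)
kbar-InKbar {m = m} inv = m , inv , λ i j i≢j → kbarμ-light i≢j , kbarμ-heavy i≢j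

pairWithNew : (Fin k → Fin k) → Fin k → Fin (suc k) → Fin (suc k)
pairWithNew m i₀ zero = suc i₀
pairWithNew m i₀ (suc i) with i ≟ i₀
... | yes _ = zero
... | no _ = suc (m i)

pairWithNew-involutive : {m : Fin k → Fin k} {i₀ : Fin k} → IsInvolution m → m i₀ ≡ i₀ →
  IsInvolution (pairWithNew m i₀)
pairWithNew-involutive {i₀ = i₀} inv fixed zero with i₀ ≟ i₀
... | yes _ = refl
... | no i₀≢i₀ = ⊥-elim (i₀≢i₀ refl)
pairWithNew-involutive {m = m} {i₀} inv fixed (suc i) with i ≟ i₀
... | yes refl = refl
... | no i≢i₀ with m i ≟ i₀
...   | yes mi≡i₀ = ⊥-elim (i≢i₀ (trans (sym (inv i)) (trans (cong m mi≡i₀) fixed)))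
...   | no _ = cong suc (inv i)

unmatch : (Fin k → Fin k) → Fin k → Fin k → Fin k
unmatch m i₀ i with i ≟ i₀ ⊎-dec m i ≟ i₀
... | yes _ = i
... | no _ = m i

unmatch-fixes : {m : Fin k → Fin k} {i₀ i : Fin k} → i ≡ i₀ ⊎ m i ≡ i₀ → unmatch m i₀ i ≡ i
unmatch-fixes {m = m} {i₀} {i} touched with i ≟ i₀ ⊎-dec m i ≟ i₀
... | yes _ = refl
... | no untouched = ⊥-elim (untouched touched)

unmatch-keeps : {m : Fin k → Fin k} {i₀ i : Fin k} → i ≢ i₀ → m i ≢ i₀ → unmatch m i₀ i ≡ m i
unmatch-keeps {m = m} {i₀} {i} i≢i₀ mi≢i₀ with i ≟ i₀ ⊎-dec m i ≟ i₀
... | yes touched = ⊥-elim ([ i≢i₀ , mi≢i₀ ]′ touched)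
... | no _ = refl

unmatch-involutive : {m : Fin k → Fin k} {i₀ : Fin k} → IsInvolution m → IsInvolution (unmatch m i₀)
unmatch-involutive {m = m} {i₀} inv i = byCases (i ≟ i₀ ⊎-dec m i ≟ i₀)
  where
  byCases : Dec (i ≡ i₀ ⊎ m i ≡ i₀) → unmatch m i₀ (unmatch m i₀ i) ≡ i
  byCases (yes touched) = trans (cong (unmatch m i₀) (unmatch-fixes touched)) (unmatch-fixes touched)
  byCases (no untouched) = trans (cong (unmatch m i₀) (unmatch-keeps (untouched ∘ inj₁) (untouched ∘ inj₂)))
    (trans (unmatch-keeps (untouched ∘ inj₂) (untouched ∘ inj₁ ∘ trans (sym (inv i)))) (inv i))

isMoved : (Fin k → Fin k) → Fin k → ℕ
isMoved m i = if does (m i ≟ i) then 0 else 1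

moved : (Fin k → Fin k) → ℕ
moved m = ∑Fin (isMoved m)

moved-unmatch : {m : Fin k → Fin k} {i₀ : Fin k} → m i₀ ≢ i₀ → moved (unmatch m i₀) < moved m
moved-unmatch {m = m} {i₀} mi₀≢i₀ = ∑Fin-< (λ i → byCases i (i ≟ i₀ ⊎-dec m i ≟ i₀)) i₀ strict
  where
  byCases : ∀ i → Dec (i ≡ i₀ ⊎ m i ≡ i₀) → isMoved (unmatch m i₀) i ≤ isMoved m i
  byCases i (yes touched) rewrite unmatch-fixes {m = m} touched | dec-true (i ≟ i) refl = z≤n
  byCases i (no untouched) rewrite unmatch-keeps {m = m} (untouched ∘ inj₁) (untouched ∘ inj₂) = ≤-refl
  strict : isMoved (unmatch m i₀) i₀ < isMoved m i₀
  strict rewrite unmatch-fixes {m = m} {i₀} (inj₁ refl) | dec-true (i₀ ≟ i₀) refl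
               | dec-false (m i₀ ≟ i₀) mi₀≢i₀ = s≤s z≤n

minList-≤-∈ : ∀ {a w ws} → w ∈ ws → minList a ws ≤ w
minList-≤-∈ {w = w} (here refl) = m⊓n≤m w _
minList-≤-∈ {w = w} (there w∈ws) = ≤-trans (m⊓n≤n _ _) (minList-≤-∈ w∈ws)

minList-≤-head : ∀ a ws → minList a ws ≤ a
minList-≤-head a []       = ≤-refl
minList-≤-head a (w ∷ ws) = ≤-trans (m⊓n≤n w _) (minList-≤-head a ws)

δ≤deg : ∀ {n} (G : StdMultigraph n) u → δ G ≤ deg G u
δ≤deg {suc n} G zero    = minList-≤-head (deg G zero) (map (deg G ∘ suc) (allFin n))
δ≤deg {suc n} G (suc i) = minList-≤-∈ (∈-map⁺ (deg G ∘ suc) (∈-allFin i))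

n*δ≤degSum : ∀ {n} (G : StdMultigraph n) → n * δ G ≤ degSum G
n*δ≤degSum {n} G = begin
  n * δ G                     ≡⟨ cong (_* δ G) (length-tabulate {n = n} id) ⟨
  length (allFin n) * δ G     ≡⟨ ∑-const (allFin n) (δ G) ⟨
  ∑ (allFin n) (const (δ G))  ≤⟨ ∑-mono (universal (δ≤deg G) (allFin n)) ⟩
  degSum G                    ∎
  where open ≤-Reasoning

minDegree⇒degSum : ∀ {n} (G : StdMultigraph n) → 2 * a * n < suc a * δ G → 2 * a * (n * n) < suc a * degSum G
minDegree⇒degSum {a} {zero} G h = ⊥-elim (<-irrefl refl (subst₂ _<_ (*-zeroʳ (2 * a)) (*-zeroʳ (suc a)) h))
minDegree⇒degSum {a} {n@(suc _)} G h = begin-strict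
  2 * a * (n * n)       ≡⟨ *-assoc (2 * a) n n ⟨
  2 * a * n * n         <⟨ *-monoˡ-< n h ⟩
  suc a * δ G * n       ≡⟨ trans (*-assoc (suc a) (δ G) n) (cong (suc a *_) (*-comm (δ G) n)) ⟩
  suc a * (n * δ G)     ≤⟨ *-monoʳ-≤ (suc a) (n*δ≤degSum G) ⟩
  suc a * degSum G      ∎
  where open ≤-Reasoning

module _ {n : ℕ} (G : StdMultigraph n) where

  ≤μ-sym : ∀ {p u v} → p ≤ μ G u v → p ≤ μ G v u
  ≤μ-sym {p} {u} {v} = subst (p ≤_) (μ-sym G u v)

  ≤μ-cong : ∀ {p u u′ v v′} → u ≡ u′ → v ≡ v′ → p ≤ μ G u v → p ≤ μ G u′ v′
  ≤μ-cong refl refl p≤μ = p≤μ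

  adjacent⇒distinct : ∀ {u v} → 1 ≤ μ G u v → u ≢ v
  adjacent⇒distinct {u} 1≤μ refl = <⇒≱ 1≤μ (≤-reflexive (loopless G u))

  degSumOn : List (Fin n) → ℕ
  degSumOn L = ∑ L λ u → ∑ L (μ G u)

  cross : List (Fin n) → List (Fin n) → ℕ
  cross A B = ∑ A λ u → ∑ B (μ G u)

  degSumOn-↭ : ∀ {L L′} → L ↭ L′ → degSumOn L ≡ degSumOn L′
  degSumOn-↭ {L} {L′} L↭L′ =
    trans (∑-cong L (λ u → ∑-↭ (μ G u) L↭L′)) (∑-↭ (λ u → ∑ L′ (μ G u)) L↭L′)

  degSumOn-++ : ∀ X Y → degSumOn (X ++ Y) ≡ degSumOn X + 2 * cross Y X + degSumOn Y
  degSumOn-++ X Y = begin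
    degSumOn (X ++ Y)
      ≡⟨ ∑-cong (X ++ Y) (λ u → ∑-++ X Y (μ G u)) ⟩
    ∑ (X ++ Y) (λ u → ∑ X (μ G u) + ∑ Y (μ G u))
      ≡⟨ trans (∑-++ X Y _) (cong₂ _+_ (∑-+ X _ _) (∑-+ Y _ _)) ⟩
    (degSumOn X + cross X Y) + (cross Y X + degSumOn Y)
      ≡⟨ cong (λ e → (degSumOn X + e) + (cross Y X + degSumOn Y)) cross-sym ⟩
    (degSumOn X + cross Y X) + (cross Y X + degSumOn Y)
      ≡⟨ rearrange (degSumOn X) (cross Y X) (degSumOn Y) ⟩
    degSumOn X + 2 * cross Y X + degSumOn Y ∎
    where
    open ≡-Reasoning
    cross-sym : cross X Y ≡ cross Y X
    cross-sym = trans (∑-comm X Y (μ G)) (∑-cong Y λ v → ∑-cong X λ u → μ-sym G u v)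
    rearrange : ∀ x e y → (x + e) + (e + y) ≡ x + 2 * e + y
    rearrange = solve-∀

  record KbarCopy (k : ℕ) : Set where
    field
      φ : Fin k → Fin n
      m : Fin k → Fin k
      m-involutive : IsInvolution m
      light : ∀ i j → i ≢ j → 1 ≤ μ G (φ i) (φ j)
      heavy : ∀ i j → i ≢ j → j ≢ m i → 2 ≤ μ G (φ i) (φ j)

    φ-injective : Injective _≡_ _≡_ φ
    φ-injective {i} {j} φi≡φj with i ≟ j
    ... | yes i≡j = i≡j
    ... | no i≢j = ⊥-elim (adjacent⇒distinct (light i j i≢j) φi≡φj)

    contains : Σ (StdMultigraph k) λ U → InKbar U × ContainsCopy G U
    contains = kbar m m-involutive , kbar-InKbar m-involutive , φ , φ-injective , edge
      where
      edge : ∀ i j → i ≢ j → kbarμ m i j ≤ μ G (φ i) (φ j)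
      edge i j i≢j with j ≟ m i
      ... | yes j≡mi = subst (_≤ μ G (φ i) (φ j)) (sym (kbarμ-light i≢j j≡mi)) (light i j i≢j)
      ... | no j≢mi = subst (_≤ μ G (φ i) (φ j)) (sym (kbarμ-heavy i≢j j≢mi)) (heavy i j i≢j j≢mi)

  singleton : Fin n → KbarCopy 1
  singleton u = record
    { φ = const u ; m = id ; m-involutive = λ _ → refl
    ; light = λ i j → ⊥-elim ∘ Fin1-distinct i j ; heavy = λ i j i≢j _ → ⊥-elim (Fin1-distinct i j i≢j) }
    where
    Fin1-distinct : (i j : Fin 1) → i ≢ j → ⊥
    Fin1-distinct zero zero 0≢0 = 0≢0 refl

  module _ (c : KbarCopy k) (y : Fin n) where
    open KbarCopy c

    extend : (m′ : Fin (suc k) → Fin (suc k)) → IsInvolution m′ →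
      (∀ i → 1 ≤ μ G y (φ i)) →
      (∀ i → suc i ≢ m′ zero → 2 ≤ μ G y (φ i)) →
      (∀ i j → i ≢ j → suc j ≢ m′ (suc i) → j ≢ m i) →
      KbarCopy (suc k)
    extend m′ inv′ toY-light toY-heavy oldPairs = record
      { φ = y Vector.∷ φ ; m = m′ ; m-involutive = inv′ ; light = light′ ; heavy = heavy′ }
      where
      light′ : ∀ i j → i ≢ j → 1 ≤ μ G ((y Vector.∷ φ) i) ((y Vector.∷ φ) j)
      light′ zero    zero    0≢0 = ⊥-elim (0≢0 refl)
      light′ zero    (suc j) _   = toY-light j
      light′ (suc i) zero    _   = ≤μ-sym (toY-light i)
      light′ (suc i) (suc j) i≢j = light i j (i≢j ∘ cong suc)
      heavy′ : ∀ i j → i ≢ j → j ≢ m′ i → 2 ≤ μ G ((y Vector.∷ φ) i) ((y Vector.∷ φ) j)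
      heavy′ zero    zero    0≢0 _     = ⊥-elim (0≢0 refl)
      heavy′ zero    (suc j) _   j≢m′0 = toY-heavy j j≢m′0
      heavy′ (suc i) zero    _   0≢m′i = ≤μ-sym (toY-heavy i (0≢m′i ∘ involution-swap {m = m′} inv′))
      heavy′ (suc i) (suc j) i≢j j≢m′i = heavy i j (i≢j ∘ cong suc) (oldPairs i j (i≢j ∘ cong suc) j≢m′i)

    extendHeavy : (∀ i → 2 ≤ μ G y (φ i)) → KbarCopy (suc k)
    extendHeavy toY = extend (zero Vector.∷ suc ∘ m) inv′ (<⇒≤ ∘ toY) (λ i _ → toY i)
      (λ i j _ sj≢smi j≡mi → sj≢smi (cong suc j≡mi))
      where
      inv′ : IsInvolution (zero Vector.∷ suc ∘ m)
      inv′ zero    = refl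
      inv′ (suc i) = cong suc (m-involutive i)

    extendLight : (i₀ : Fin k) → m i₀ ≡ i₀ → HeavyExcept (λ i → μ G y (φ i)) i₀ → KbarCopy (suc k)
    extendLight i₀ fixed toY@(_ , toY-heavy) =
      extend (pairWithNew m i₀) (pairWithNew-involutive m-involutive fixed) (HeavyExcept⇒positive toY)
        (λ i si≢si₀ → toY-heavy i (si≢si₀ ∘ cong suc)) oldPairs
      where
      oldPairs : ∀ i j → i ≢ j → suc j ≢ pairWithNew m i₀ (suc i) → j ≢ m i
      oldPairs i j i≢j sj≢ j≡mi with i ≟ i₀
      ... | yes i≡i₀ = i≢j (sym (trans j≡mi (trans (cong m i≡i₀) (trans fixed (sym i≡i₀)))))
      ... | no _ = sj≢ (cong suc j≡mi)

    exchange : (i₀ : Fin k) → HeavyExcept (λ i → μ G y (φ i)) i₀ → KbarCopy k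
    exchange i₀ toY@(_ , toY-heavy) = record
      { φ = φ′ ; m = unmatch m i₀ ; m-involutive = unmatch-involutive m-involutive
      ; light = λ i j i≢j → updated-edge i j i≢j (λ l _ → HeavyExcept⇒positive toY l) (λ _ _ → light i j i≢j)
      ; heavy = λ i j i≢j j≢m′i → updated-edge i j i≢j toY-heavy λ i≢i₀ j≢i₀ →
          heavy i j i≢j λ j≡mi → j≢m′i (trans j≡mi (sym (unmatch-keeps i≢i₀ (j≢i₀ ∘ trans j≡mi)))) }
      where
      φ′ : Fin k → Fin n
      φ′ = updateAt φ i₀ (const y)
      updated-edge : ∀ {p} i j → i ≢ j → (∀ l → l ≢ i₀ → p ≤ μ G y (φ l)) →
        (i ≢ i₀ → j ≢ i₀ → p ≤ μ G (φ i) (φ j)) → p ≤ μ G (φ′ i) (φ′ j)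
      updated-edge i j i≢j toY old with i ≟ i₀ | j ≟ i₀
      ... | yes refl | yes refl = ⊥-elim (i≢j refl)
      ... | yes refl | no j≢i₀ =
        ≤μ-cong (sym (updateAt-updates i₀ φ)) (sym (updateAt-minimal j i₀ φ j≢i₀)) (toY j j≢i₀)
      ... | no i≢i₀ | yes refl =
        ≤μ-cong (sym (updateAt-minimal i i₀ φ i≢i₀)) (sym (updateAt-updates i₀ φ)) (≤μ-sym (toY i i≢i₀))
      ... | no i≢i₀ | no j≢i₀ =
        ≤μ-cong (sym (updateAt-minimal i i₀ φ i≢i₀)) (sym (updateAt-minimal j i₀ φ j≢i₀)) (old i≢i₀ j≢i₀)

  record CopyIn (k : ℕ) (L : List (Fin n)) : Set where
    field
      copy : KbarCopy k
      rest : List (Fin n)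
      split : L ↭ image (KbarCopy.φ copy) ++ rest
    open KbarCopy copy public

  module _ {L : List (Fin n)} (c : CopyIn k L) where
    open CopyIn c

    length-split : length L ≡ k + length rest
    length-split = trans (↭-length split) (trans (length-++ (image φ)) (cong (_+ length rest) (length-image φ)))

    relocate : (c′ : KbarCopy t) (Z : List (Fin n)) → image φ ++ rest ↭ image (KbarCopy.φ c′) ++ Z → CopyIn t L
    relocate c′ Z ↭Z = record { copy = c′ ; rest = Z ; split = ↭-trans split ↭Z }

    CopyIn-fromRest : CopyIn t rest → CopyIn t L
    CopyIn-fromRest c′ = record
      { copy = CopyIn.copy c′
      ; rest = image φ ++ CopyIn.rest c′
      ; split = ↭-trans split (↭-trans (++⁺ˡ (image φ) (CopyIn.split c′)) (shifts (image φ) (image (CopyIn.φ c′)))) }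

  degInto : (Fin k → Fin n) → Fin n → ℕ
  degInto φ y = ∑Fin λ i → μ G y (φ i)

  Saturated : ∀ {L} → CopyIn (suc a) L → Set
  Saturated {a} c = All (λ y → degInto (CopyIn.φ c) y ≤ a * 2) (CopyIn.rest c)

  grow-or-saturate : ∀ {L} (c : CopyIn (suc a) L) → Acc _<_ (moved (CopyIn.m c)) →
    CopyIn (2 + a) L ⊎ Σ (CopyIn (suc a) L) Saturated
  grow-or-saturate {a} c (acc smaller)
    with All-or-extract (λ y → degInto (CopyIn.φ c) y ≤? a * 2) (CopyIn.rest c)
  ... | inj₁ saturated = inj₂ (c , saturated)
  ... | inj₂ (y , Z , rest↭ , dense)
    with almostFull⇒heavyExcept (λ i → μ G y (CopyIn.φ c i)) (λ i → le2 G _ _) (s≤s (≰⇒> dense))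
  ...   | inj₁ allHeavy =
    inj₁ (relocate c (extendHeavy (CopyIn.copy c) y allHeavy) Z (++-attach (CopyIn.φ c) rest↭))
  ...   | inj₂ (i₀ , heavyExcept) with CopyIn.m c i₀ ≟ i₀
  ...     | yes fixed =
    inj₁ (relocate c (extendLight (CopyIn.copy c) y i₀ fixed heavyExcept) Z (++-attach (CopyIn.φ c) rest↭))
  ...     | no unfixed = grow-or-saturate
    (relocate c (exchange (CopyIn.copy c) y i₀ heavyExcept) (CopyIn.φ c i₀ ∷ Z) (++-exchange (CopyIn.φ c) i₀ rest↭))
    (smaller (moved-unmatch unfixed))

  TuránBound : ℕ → List (Fin n) → Set
  TuránBound a L = suc a * degSumOn L ≤ 2 * a * (length L * length L)

  TuránBound-suc : ∀ {L} → TuránBound a L → TuránBound (suc a) L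
  TuránBound-suc {a} {L} bound = *-cancelˡ-≤ (suc a) (begin
    suc a * (suc (suc a) * D)          ≡⟨ exchange-factors a D ⟩
    suc (suc a) * (suc a * D)          ≤⟨ *-monoʳ-≤ (suc (suc a)) bound ⟩
    suc (suc a) * (2 * a * Q)          ≤⟨ m≤m+n _ (2 * Q) ⟩
    suc (suc a) * (2 * a * Q) + 2 * Q  ≡⟨ complete-square a Q ⟩
    suc a * (2 * suc a * Q)            ∎)
    where
    open ≤-Reasoning
    D = degSumOn L
    Q = length L * length L
    exchange-factors : ∀ a D → suc a * (suc (suc a) * D) ≡ suc (suc a) * (suc a * D)
    exchange-factors = solve-∀
    complete-square : ∀ a Q → suc (suc a) * (2 * a * Q) + 2 * Q ≡ suc a * (2 * suc a * Q)
    complete-square = solve-∀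

  degSumOn-image : (φ : Fin (suc a) → Fin n) → degSumOn (image φ) ≤ suc a * (a * 2)
  degSumOn-image {a} φ = begin
    degSumOn (image φ)
      ≡⟨ trans (∑-map φ (allFin (suc a)) _) (∑-cong (allFin (suc a)) λ i → ∑-map φ (allFin (suc a)) (μ G (φ i))) ⟩
    ∑Fin (λ i → ∑Fin λ j → μ G (φ i) (φ j))
      ≤⟨ ∑Fin-mono (λ i → ∑Fin-≤-with-zero i (loopless G (φ i)) (λ j → le2 G (φ i) (φ j))) ⟩
    ∑Fin (λ (_ : Fin (suc a)) → a * 2)
      ≤⟨ ∑Fin-≤ {t = suc a} {c = a * 2} (λ _ → ≤-refl) ⟩
    suc a * (a * 2) ∎
    where open ≤-Reasoning

  cross-saturated : ∀ {L} (c : CopyIn (suc a) L) → Saturated c →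
    cross (CopyIn.rest c) (image (CopyIn.φ c)) ≤ length (CopyIn.rest c) * (a * 2)
  cross-saturated {a} c saturated = begin
    cross Y (image φ)     ≡⟨ ∑-cong Y (λ u → ∑-map φ (allFin (suc a)) (μ G u)) ⟩
    ∑ Y (degInto φ)       ≤⟨ ∑-mono saturated ⟩
    ∑ Y (const (a * 2))   ≡⟨ ∑-const Y (a * 2) ⟩
    length Y * (a * 2)    ∎
    where
    open ≤-Reasoning
    open CopyIn c using (φ) renaming (rest to Y)

  TuránBound-join : ∀ {L} (c : CopyIn (suc a) L) → Saturated c → TuránBound a (CopyIn.rest c) → TuránBound a L
  TuránBound-join {a} {L} c saturated restBound = begin
    suc a * degSumOn L
      ≡⟨ cong (suc a *_) (trans (degSumOn-↭ split) (degSumOn-++ X Y)) ⟩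
    suc a * (degSumOn X + 2 * cross Y X + degSumOn Y)
      ≡⟨ distribute a (degSumOn X) (cross Y X) (degSumOn Y) ⟩
    suc a * degSumOn X + 2 * (suc a * cross Y X) + suc a * degSumOn Y
      ≤⟨ +-mono-≤ (+-mono-≤ (*-monoʳ-≤ (suc a) (degSumOn-image φ))
                            (*-monoʳ-≤ 2 (*-monoʳ-≤ (suc a) (cross-saturated c saturated))))
                  restBound ⟩
    suc a * (suc a * (a * 2)) + 2 * (suc a * (length Y * (a * 2))) + 2 * a * (length Y * length Y)
      ≡⟨ complete-square a (length Y) ⟩
    2 * a * ((suc a + length Y) * (suc a + length Y))
      ≡⟨ cong (λ l → 2 * a * (l * l)) (length-split c) ⟨
    2 * a * (length L * length L) ∎
    where
    open ≤-Reasoning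
    open CopyIn c using (φ; split) renaming (rest to Y)
    X = image φ
    distribute : ∀ a x e y → suc a * (x + 2 * e + y) ≡ suc a * x + 2 * (suc a * e) + suc a * y
    distribute = solve-∀
    complete-square : ∀ a y →
      suc a * (suc a * (a * 2)) + 2 * (suc a * (y * (a * 2))) + 2 * a * (y * y) ≡ 2 * a * ((suc a + y) * (suc a + y))
    complete-square = solve-∀

  turán-step : (∀ L → CopyIn (suc a) L ⊎ TuránBound a L) →
    ∀ L → Acc _<_ (length L) → CopyIn (2 + a) L ⊎ TuránBound a L
  turán-step {a} previous L (acc shorter) with previous L
  ... | inj₂ bound = inj₂ bound
  ... | inj₁ c with grow-or-saturate c (<-wellFounded _)
  ...   | inj₁ bigger = inj₁ bigger
  ...   | inj₂ (c′ , saturated) with turán-step previous (CopyIn.rest c′) (shorter restShorter)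
    where
    restShorter : length (CopyIn.rest c′) < length L
    restShorter = ≤-trans (s≤s (m≤n+m _ a)) (≤-reflexive (sym (length-split c′)))
  ...     | inj₁ inRest = inj₁ (CopyIn-fromRest c′ inRest)
  ...     | inj₂ restBound = inj₂ (TuránBound-join c′ saturated restBound)

  copy-or-bound : ∀ a L → CopyIn (suc a) L ⊎ TuránBound a L
  turán : ∀ a L → CopyIn (2 + a) L ⊎ TuránBound a L

  copy-or-bound zero []      = inj₂ z≤n
  copy-or-bound zero (u ∷ L) = inj₁ record { copy = singleton u ; rest = L ; split = ↭-refl }
  copy-or-bound (suc a) L    = map₂ (TuránBound-suc {a} {L}) (turán a L)

  turán a L = turán-step (copy-or-bound a) L (<-wellFounded (length L))

corollary4p3 : (r n : ℕ) → 2 ≤ r → (G : StdMultigraph n) →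
    (2 * (r ∸ 2) * n < (r ∸ 1) * δ G ⊎ 2 * (r ∸ 2) * (n * n) < (r ∸ 1) * degSum G) →
    Σ (StdMultigraph r) λ U → InKbar U × ContainsCopy G U
corollary4p3 (suc zero) n (s≤s ()) G dense
corollary4p3 (suc (suc a)) n _ G dense with turán G a (allFin n)
... | inj₁ c = KbarCopy.contains (CopyIn.copy c)
... | inj₂ bound = ⊥-elim (<⇒≱ ([ minDegree⇒degSum {a} G , id ]′ dense) sparse)
  where
  sparse : suc a * degSum G ≤ 2 * a * (n * n)
  sparse = subst (λ l → suc a * degSum G ≤ 2 * a * (l * l)) (length-tabulate {n = n} id) bound
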